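{- Let $X$ be a finite totally ordered alphabet and $U\subseteq X\times X$. Suppose $\mathrm{inv}'_U$ and $\mathrm{maj}'_U$ are equidistributed on every rearrangement class of words over $X$. Then either there is a block $B_1$ of $X_U$ such that $(x,y)\notin U$ for all $x\in B_1$ and all $y\in X\setminus B_1$, or there exists $x\in X\setminus X_U$ such that $(x,y)\notin U$ for all $y\in X$.
   Context: $S(U)=\{(x,y):(x,y)\in U\text{ and }(y,x)\in U\}$; $X_U$ is the set of $x\in X$ with $(x,y)\in S(U)$ for some $y$. Under the equidistribution hypothesis $S(U)$ is an equivalence relation on $X_U$, and the blocks of $X_U$ are its equivalence classes. Words over $X$: finite sequences $w=x_1\cdots x_m$; a rearrangement class is the set of all words with prescribed numbers of occurrences of each letter. $\mathrm{maj}'_U w=\sum_{i=1}^{m-1}i\,\chi((x_i,x_{i+1})\in U)$, $\mathrm{inv}'_U w=\sum_{1\le i<j\le m}\chi((x_i,x_j)\in U)$. Equidistributed on a class: for each $k$ the numbers of words with statistic value $k$ coincide. -}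

module Defs where

open import Data.Nat using (ℕ; zero; suc; _+_; _*_)
open import Data.Bool using (Bool; true; false; if_then_else_; _∧_)
open import Data.Fin using (Fin)
open import Data.Fin.Properties using (_≟_)
open import Data.List using (List; []; _∷_; [_]; length; filter; map; concatMap; allFin; foldr)
open import Relation.Nullary using (does)
open import Relation.Binary.PropositionalEquality using (_≡_)
open import Data.Product using (_×_; ∃-syntax)

-- The alphabet X is Fin n (ordered as usual); a relation U ⊆ X × X is a
-- Boolean-valued function: (x , y) ∈ U  iff  U x y ≡ true.
BRel : ℕ → Set
BRel n = Fin n → Fin n → Bool

Word : ℕ → Set
Word n = List (Fin n)

-- maj'_U w = Σ_{i=1}^{m-1} i · χ((x_i , x_{i+1}) ∈ U)
majFrom : ∀ {n} → BRel n → ℕ → Word n → ℕ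
majFrom U i []           = 0
majFrom U i (x ∷ [])     = 0
majFrom U i (x ∷ y ∷ w)  = (if U x y then i else 0) + majFrom U (suc i) (y ∷ w)

maj' : ∀ {n} → BRel n → Word n → ℕ
maj' U w = majFrom U 1 w

countU : ∀ {n} → BRel n → Fin n → Word n → ℕ
countU U x []      = 0
countU U x (y ∷ w) = (if U x y then 1 else 0) + countU U x w

-- inv'_U w = Σ_{i<j} χ((x_i , x_j) ∈ U)
inv' : ∀ {n} → BRel n → Word n → ℕ
inv' U []      = 0
inv' U (x ∷ w) = countU U x w + inv' U w

occ : ∀ {n} → Fin n → Word n → ℕ
occ x w = length (filter (λ y → x ≟ y) w)

words : ∀ {n} → ℕ → List (Word n)
words zero    = [ [] ]
words {n} (suc m) = concatMap (λ x → map (x ∷_) (words m)) (allFin n)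

sameContent : ∀ {n} → Word n → Word n → Bool
sameContent {n} w v = foldr (λ x b → does (occ x w Data.Nat.≟ occ x v) ∧ b) true (allFin n)

-- the rearrangement class of v (a list without repetitions of all words
-- with the same multiplicity of each letter as v)
rearr : ∀ {n} → Word n → List (Word n)
rearr v = filter (λ w → sameContent w v Data.Bool.≟ true) (words (length v))

numWith : ∀ {n} → (Word n → ℕ) → ℕ → List (Word n) → ℕ
numWith st k ws = length (filter (λ w → st w Data.Nat.≟ k) ws)

Equidistributed : ∀ {n} → BRel n → Set
Equidistributed U = ∀ v k → numWith (inv' U) k (rearr v) ≡ numWith (maj' U) k (rearr v)

S : ∀ {n} → BRel n → Fin n → Fin n → Set
S U x y = (U x y ≡ true) × (U y x ≡ true)

InXU : ∀ {n} → BRel n → Fin n → Set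
InXU U x = ∃[ y ] S U x y

InBlock : ∀ {n} → BRel n → Fin n → Fin n → Set
InBlock U x z = S U x z

-- Equidistribution on the rearrangement class of a word a b c with (a,b), (b,c) ∈ U forces
-- (a,c) ∈ U: on words of length 3 the value 3 of inv'_U is only reached when all three pairs
-- lie in U, and then maj'_U is 3 as well; so the words with inv'_U = 3 are among those with
-- maj'_U = 3, equinumerosity makes the two sets equal, and a b c has maj'_U = 3. Hence U is
-- transitive, and its strict part is a strict partial order on the finite set X, which
-- therefore has a maximal element x: (x,y) ∈ U implies (y,x) ∈ U. If (x,x) ∈ U, the block of
-- x is closed under U-successors; otherwise x ∉ X_U and x has no U-successor at all.
module Submission where

open import Defs
open import Data.Nat using (ℕ; zero; suc)
open import Data.Fin using (Fin)
open import Data.Fin.Properties using (any?)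
open import Data.Fin.Induction using (spo-noetherian)
open import Data.Bool using (true; false; _∧_)
open import Data.Bool.Properties using (¬-not; not-¬)
open import Data.Product using (_×_; ∃-syntax; _,_; proj₁; proj₂)
open import Data.Sum using (_⊎_; inj₁; inj₂)
open import Data.List using ([]; _∷_; length; filter; map; foldr; allFin)
open import Data.List.Properties using (filter-complete)
open import Data.List.Membership.Propositional using (_∈_; lose)
open import Data.List.Membership.Propositional.Properties
  using (∈-filter⁺; ∈-filter⁻; ∈-concatMap⁺; ∈-concatMap⁻; ∈-map⁺; ∈-map⁻; ∈-allFin)
open import Data.List.Relation.Unary.All using (All; []; _∷_; tabulate)
open import Data.List.Relation.Unary.Any using (here; satisfied)
open import Function using (flip)
open import Induction.WellFounded using (Acc; acc)
open import Level using (Level; 0ℓ)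
open import Relation.Binary using (Rel; Decidable; Transitive; IsStrictPartialOrder)
open import Relation.Binary.PropositionalEquality
  using (_≡_; refl; sym; trans; cong; subst; isEquivalence; resp₂; module ≡-Reasoning)
open import Relation.Nullary using (¬_; yes; no; does; ¬?; contradiction)
open import Relation.Nullary.Decidable using (dec-true; decidable-stable; _×-dec_)
open import Relation.Unary using (Pred; _⇒_)
import Relation.Unary as Unary

private
  variable
    a ℓ : Level
    A : Set a
    n : ℕ

module _ {P Q : Pred A ℓ} (P? : Unary.Decidable P) (Q? : Unary.Decidable Q) where

  filter-absorbs : ∀ {xs} → All (P ⇒ Q) xs → filter P? (filter Q? xs) ≡ filter P? xs
  filter-absorbs []                             = refl
  filter-absorbs {xs = x ∷ _} (Px⇒Qx ∷ P⇒Qs) with Q? x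
  ... | yes _ with P? x
  ...   | yes _ = cong (x ∷_) (filter-absorbs P⇒Qs)
  ...   | no  _ = filter-absorbs P⇒Qs
  filter-absorbs {xs = x ∷ _} (Px⇒Qx ∷ P⇒Qs) | no ¬Qx with P? x
  ...   | yes Px = contradiction (Px⇒Qx Px) ¬Qx
  ...   | no  _  = filter-absorbs P⇒Qs

  filter-length-≡⇒≡ : ∀ {xs} → All (P ⇒ Q) xs →
                      length (filter P? xs) ≡ length (filter Q? xs) →
                      filter P? xs ≡ filter Q? xs
  filter-length-≡⇒≡ {xs} P⇒Q eq = begin
    filter P? xs              ≡⟨ sym (filter-absorbs P⇒Q) ⟩
    filter P? (filter Q? xs)  ≡⟨ filter-complete P? (trans (cong length (filter-absorbs P⇒Q)) eq) ⟩
    filter Q? xs              ∎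
    where open ≡-Reasoning

words-length : ∀ m {w : Word n} → w ∈ words m → length w ≡ m
words-length zero    (here refl) = refl
words-length {n} (suc m) w∈
  with x , w∈x∷words ← satisfied (∈-concatMap⁻ (λ x → map (x ∷_) (words m)) {xs = allFin n} w∈)
  with w , w∈words , refl ← ∈-map⁻ (x ∷_) w∈x∷words
  = cong suc (words-length m w∈words)

∈-words : (w : Word n) → w ∈ words (length w)
∈-words []      = here refl
∈-words (x ∷ w) = ∈-concatMap⁺ (λ y → map (y ∷_) (words (length w)))
  (lose (∈-allFin x) (∈-map⁺ (x ∷_) (∈-words w)))

sameContent-refl : (w : Word n) → sameContent w w ≡ true
sameContent-refl {n} w = go (allFin n)
  where
  go : ∀ xs → foldr (λ x b → does (occ x w Data.Nat.≟ occ x w) ∧ b) true xs ≡ true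
  go []       = refl
  go (x ∷ xs) rewrite dec-true (occ x w Data.Nat.≟ occ x w) refl = go xs

∈-rearr : (v : Word n) → v ∈ rearr v
∈-rearr v = ∈-filter⁺ _ (∈-words v) (sameContent-refl v)

rearr-length : ∀ (v : Word n) {w} → w ∈ rearr v → length w ≡ length v
rearr-length v w∈ = words-length (length v) (proj₁ (∈-filter⁻ _ {xs = words (length v)} w∈))

Holds : BRel n → Rel (Fin n) 0ℓ
Holds U x y = U x y ≡ true

module _ (U : BRel n) where

  inv'-triple≡3 : ∀ x y z → inv' U (x ∷ y ∷ z ∷ []) ≡ 3 → Holds U x y × Holds U x z × Holds U y z
  inv'-triple≡3 x y z with U x y | U x z | U y z
  ... | true  | true  | true  = λ _ → refl , refl , refl
  ... | true  | true  | false = λ ()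
  ... | true  | false | true  = λ ()
  ... | true  | false | false = λ ()
  ... | false | true  | true  = λ ()
  ... | false | true  | false = λ ()
  ... | false | false | true  = λ ()
  ... | false | false | false = λ ()

  maj'-chain≡3 : ∀ {x y z} → Holds U x y → Holds U y z → maj' U (x ∷ y ∷ z ∷ []) ≡ 3
  maj'-chain≡3 Uxy Uyz rewrite Uxy | Uyz = refl

  inv'≡3⇒maj'≡3 : ∀ {w} → length w ≡ 3 → inv' U w ≡ 3 → maj' U w ≡ 3
  inv'≡3⇒maj'≡3 {x ∷ y ∷ z ∷ []} _ inv≡3 with Uxy , _ , Uyz ← inv'-triple≡3 x y z inv≡3 =
    maj'-chain≡3 Uxy Uyz

  equidistributed⇒transitive : Equidistributed U → Transitive (Holds U)
  equidistributed⇒transitive E {x} {y} {z} Uxy Uyz = proj₁ (proj₂ (inv'-triple≡3 x y z inv'v≡3))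
    where
    v : Word n
    v = x ∷ y ∷ z ∷ []

    inv≡3? : Unary.Decidable (λ w → inv' U w ≡ 3)
    maj≡3? : Unary.Decidable (λ w → maj' U w ≡ 3)
    inv≡3? w = inv' U w Data.Nat.≟ 3
    maj≡3? w = maj' U w Data.Nat.≟ 3

    inv≡3-words≡maj≡3-words : filter inv≡3? (rearr v) ≡ filter maj≡3? (rearr v)
    inv≡3-words≡maj≡3-words = filter-length-≡⇒≡ inv≡3? maj≡3?
      (tabulate (λ {w} w∈ → inv'≡3⇒maj'≡3 {w} (rearr-length v w∈))) (E v 3)

    inv'v≡3 : inv' U v ≡ 3
    inv'v≡3 = proj₂ (∈-filter⁻ inv≡3? {xs = rearr v} (subst (v ∈_) (sym inv≡3-words≡maj≡3-words)
      (∈-filter⁺ maj≡3? (∈-rearr v) (maj'-chain≡3 Uxy Uyz))))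

module _ {R : Rel (Fin n) ℓ} (R? : Decidable R) (R-trans : Transitive R) where

  private
    _⊏_ : Rel (Fin n) ℓ
    x ⊏ y = R x y × ¬ R y x

    ⊏-isStrictPartialOrder : IsStrictPartialOrder _≡_ _⊏_
    ⊏-isStrictPartialOrder = record
      { isEquivalence = isEquivalence
      ; irrefl        = λ { refl (Rxx , ¬Rxx) → ¬Rxx Rxx }
      ; trans         = λ (Rxy , ¬Ryx) (Ryz , ¬Rzy) →
                          R-trans Rxy Ryz , λ Rzx → ¬Ryx (R-trans Ryz Rzx)
      ; <-resp-≈      = resp₂ _⊏_
      }

  ∃-maximal : Fin n → ∃[ x ] (∀ y → R x y → R y x)
  ∃-maximal x₀ = go x₀ (spo-noetherian ⊏-isStrictPartialOrder x₀)
    where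
    go : ∀ x → Acc (flip _⊏_) x → ∃[ x ] (∀ y → R x y → R y x)
    go x (acc above) with any? (λ y → R? x y ×-dec ¬? (R? y x))
    ... | yes (y , x⊏y) = go y (above x⊏y)
    ... | no  ∄x⊏y      = x , λ y Rxy → decidable-stable (R? y x) (λ ¬Ryx → ∄x⊏y (y , Rxy , ¬Ryx))

module _ {U : BRel n} (U-trans : Transitive (Holds U)) {x} (x-maximal : ∀ y → Holds U x y → Holds U y x) where

  maximal-block-closed : ∀ z y → InBlock U x z → ¬ InBlock U x y → U z y ≡ false
  maximal-block-closed z y (Uxz , _) ¬Sxy = ¬-not λ Uzy →
    let Uxy = U-trans Uxz Uzy in ¬Sxy (Uxy , x-maximal y Uxy)

  maximal-irreflexive-isolated : U x x ≡ false → ¬ InXU U x × (∀ y → U x y ≡ false)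
  maximal-irreflexive-isolated Uxx≡false = (λ (y , Uxy , Uyx) → ¬Uxx (U-trans Uxy Uyx))
                                         , λ y → ¬-not λ Uxy → ¬Uxx (U-trans Uxy (x-maximal y Uxy))
    where
    ¬Uxx : ¬ Holds U x x
    ¬Uxx = not-¬ Uxx≡false

lemma6p6 : (n : ℕ) (U : BRel (suc n)) → Equidistributed U →
    (∃[ x ] (InXU U x ×
       (∀ z y → InBlock U x z → ¬ InBlock U x y → U z y ≡ false)))
    ⊎ (∃[ x ] (¬ InXU U x × (∀ y → U x y ≡ false)))
lemma6p6 n U E
  with U-trans ← equidistributed⇒transitive U E
  with x , x-maximal ← ∃-maximal (λ x y → U x y Data.Bool.≟ true) U-trans Fin.zero
  with U x x in Uxx
... | true  = inj₁ (x , (x , Uxx , Uxx) , maximal-block-closed U-trans x-maximal)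
... | false = inj₂ (x , maximal-irreflexive-isolated U-trans x-maximal Uxx)
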